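{- Let $p\ge 3$ be a prime, $b,k\in\mathbb{N}$, $l$ an odd natural number, and $2\le m<\frac{p^k-1}{2}$. If $r_{b;p^k}\in[m+1,\,p^k-m-1]$, then the equation $\sum_{i=1}^m x_i^{\varphi(p^k)l/2}=b$ has no solution in nonnegative integers.
   Context: $\varphi$ is Euler's totient function; $r_{b;c}$ denotes the remainder of the division of $b$ by $c$. -}

module Defs where

open import Data.Nat using (ℕ; zero; suc; _+_; _*_; _≟_)
open import Data.Nat.GCD using (gcd)
open import Data.List using (List; length; filter; map; upTo)
open import Data.Product using (∃)
open import Data.Fin using (Fin)
open import Data.Vec.Functional using (foldr)
open import Relation.Binary.PropositionalEquality using (_≡_)

φ : ℕ → ℕ
φ n = length (filter (λ i → gcd i n ≟ 1) (map suc (upTo n)))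

Odd : ℕ → Set
Odd l = ∃ λ j → l ≡ suc (2 * j)

Σ : ∀ {m} → (Fin m → ℕ) → ℕ
Σ f = foldr _+_ 0 f

-- Put N = p^k (so k ≥ 1, as m < (N − 1)/2) and e = φ(N) l / 2 = p^(k−1) · (p − 1)/2 · l.
-- If p ∣ x then N ∣ x^e. Otherwise y = x^(φ(N)/2) satisfies y² ≡ 1 (mod N) by Euler's theorem,
-- which follows from Fermat's little theorem by lifting through the powers of p. Then
-- N ∣ (y − 1)(y + 1), and the odd prime p divides at most one factor, so y ≡ ±1; as l is odd,
-- x^e = y^l ≡ y. Hence every summand is ≡ 0, 1 or −1 (mod N), a sum of m of them is ≡ a − s
-- with a + s ≤ m, and its residue lies within m of 0 or of N, never in [m + 1, N − m − 1].

module Submission where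

open import Defs
open import Data.Nat using (ℕ; NonZero; _+_; _*_; _∸_; _^_; _≤_; _<_)
open import Data.Nat.DivMod using (_/_; _%_)
open import Data.Nat.Primality using (Prime)
open import Data.Fin using (Fin)
open import Data.Product using (∃; _×_)
open import Relation.Binary.PropositionalEquality using (_≡_)
open import Relation.Nullary using (¬_)

open import Data.Nat
open import Data.Nat.Properties
open import Data.Nat.Divisibility
open import Data.Nat.DivMod hiding (_mod_)
open import Data.Nat.Primality
open import Data.Nat.Coprimality using (Coprime; coprime-divisor; coprime⇒gcd≡1)
import Data.Nat.Coprimality as Coprimality
open import Data.Nat.GCD using (gcd; gcd-greatest)
open import Data.Nat.Combinatorics using (_C_; nCn≡1; nCk≡n!/k![n-k]!; k![n∸k]!∣n!)
open import Data.Nat.Tactic.RingSolver using (solve-∀)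
import Data.Fin as Fin
import Data.Fin.Properties as Fin
import Data.Vec.Functional as Vector
open import Data.List using ([]; [_]; length; filter; map; upTo; _++_)
import Data.List.Properties as List
open import Data.Product using (_,_)
open import Data.Sum using (_⊎_; inj₁; inj₂; [_,_]′)
open import Data.Empty using (⊥-elim)
open import Function using (_∘_)
open import Relation.Nullary using (Dec; yes; no; contradiction)
open import Relation.Binary.PropositionalEquality
  using (refl; sym; trans; cong; cong₂; subst; subst₂; module ≡-Reasoning)
import Algebra.Properties.CommutativeSemiring.Binomial +-*-commutativeSemiring as Binomial
import Algebra.Properties.Semiring.Exp +-*-semiring as Exp
import Algebra.Properties.Semiring.Mult +-*-semiring as Mult
import Algebra.Properties.Monoid.Sum +-0-monoid as Sum

-- x ≡ y mod n also records y ≤ x, so that no truncated subtraction is needed.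
infix 4 _≡_mod_
_≡_mod_ : ℕ → ℕ → ℕ → Set
x ≡ y mod n = ∃ λ c → x ≡ y + c × n ∣ c

mod-refl : ∀ {n x} → x ≡ x mod n
mod-refl {n} {x} = 0 , sym (+-identityʳ x) , n ∣0

mod-trans : ∀ {n x y z} → x ≡ y mod n → y ≡ z mod n → x ≡ z mod n
mod-trans {z = z} (c , x≡y+c , n∣c) (d , y≡z+d , n∣d) =
  d + c , trans x≡y+c (trans (cong (_+ c) y≡z+d) (+-assoc z d c)) , ∣m∣n⇒∣m+n n∣d n∣c

mod-+ : ∀ {n x y u v} → x ≡ y mod n → u ≡ v mod n → x + u ≡ y + v mod n
mod-+ {y = y} {v = v} (c , x≡y+c , n∣c) (d , u≡v+d , n∣d) =
  c + d , trans (cong₂ _+_ x≡y+c u≡v+d) (rearrange y c v d) , ∣m∣n⇒∣m+n n∣c n∣d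
  where
  rearrange : ∀ y c v d → y + c + (v + d) ≡ y + v + (c + d)
  rearrange = solve-∀

mod-*ˡ : ∀ {n x y} a → x ≡ y mod n → a * x ≡ a * y mod n
mod-*ˡ {y = y} a (c , x≡y+c , n∣c) =
  a * c , trans (cong (a *_) x≡y+c) (*-distribˡ-+ a y c) , ∣n⇒∣m*n a n∣c

mod-∣ : ∀ {m n x y} → m ∣ n → x ≡ y mod n → x ≡ y mod m
mod-∣ m∣n (c , x≡y+c , n∣c) = c , x≡y+c , ∣-trans m∣n n∣c

mod-% : ∀ {n x y} .{{_ : NonZero n}} → x ≡ y mod n → x % n ≡ y % n
mod-% {n} {y = y} (c , x≡y+c , n∣c) = trans (cong (_% n) x≡y+c) (%-remove-+ʳ y n∣c)

[1+c]^n≡1+c*n+c*c*t : ∀ c n → ∃ λ t → (1 + c) ^ n ≡ 1 + c * n + c * c * t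
[1+c]^n≡1+c*n+c*c*t c zero = 0 , expand₀ c
  where
  expand₀ : ∀ c → 1 ≡ 1 + c * 0 + c * c * 0
  expand₀ = solve-∀
[1+c]^n≡1+c*n+c*c*t c (suc n) with [1+c]^n≡1+c*n+c*c*t c n
... | t , eq = n + t + c * t , trans (cong ((1 + c) *_) eq) (expand c n t)
  where
  expand : ∀ c n t → (1 + c) * (1 + c * n + c * c * t) ≡ 1 + c * (1 + n) + c * c * (n + t + c * t)
  expand = solve-∀

mod-^ : ∀ {n x} k → x ≡ 1 mod n → x ^ k ≡ 1 mod n
mod-^ k (c , refl , n∣c) with [1+c]^n≡1+c*n+c*c*t c k
... | t , eq = c * k + c * c * t , trans eq (+-assoc 1 (c * k) (c * c * t)) ,
               ∣m∣n⇒∣m+n (∣m⇒∣m*n k n∣c) (∣m⇒∣m*n t (∣m⇒∣m*n c n∣c))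

-- (1 + c)^d = 1 + c d + c² t, and n d divides both c d and c² since d ∣ n ∣ c.
^-lift : ∀ {d n x} → d ∣ n → x ≡ 1 mod n → x ^ d ≡ 1 mod n * d
^-lift {d} d∣n (c , refl , n∣c) with [1+c]^n≡1+c*n+c*c*t c d
... | t , eq = c * d + c * c * t , trans eq (+-assoc 1 (c * d) (c * c * t)) ,
               ∣m∣n⇒∣m+n (*-monoˡ-∣ d n∣c) (∣m⇒∣m*n t (*-pres-∣ n∣c (∣-trans d∣n n∣c)))

prime∤⇒coprime : ∀ {p n} → Prime p → ¬ p ∣ n → Coprime p n
prime∤⇒coprime p-prime p∤n (d∣p , d∣n) with prime⇒irreducible p-prime d∣p
... | inj₁ d≡1 = d≡1
... | inj₂ refl = contradiction d∣n p∤n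

coprime-^ˡ : ∀ {m n} → Coprime m n → ∀ k → Coprime (m ^ k) n
coprime-^ˡ _ zero (d∣1 , _) = ∣1⇒≡1 d∣1
coprime-^ˡ m⊥n (suc k) {d} (d∣m*m^k , d∣n) =
  coprime-^ˡ m⊥n k (coprime-divisor d⊥m d∣m*m^k , d∣n)
  where
  d⊥m : Coprime d _
  d⊥m (e∣d , e∣m) = m⊥n (e∣m , ∣-trans e∣d d∣n)

prime∤n! : ∀ {p} → Prime p → ∀ {n} → n < p → ¬ p ∣ n !
prime∤n! p-prime {zero} _ p∣1 = nonTrivial⇒≢1 {{prime⇒nonTrivial p-prime}} (∣1⇒≡1 p∣1)
prime∤n! p-prime {suc n} n<p p∣n! with euclidsLemma (suc n) (n !) p-prime p∣n!
... | inj₁ p∣1+n = <⇒≱ n<p (∣⇒≤ p∣1+n)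
... | inj₂ p∣n!′ = prime∤n! p-prime (<-trans (n<1+n n) n<p) p∣n!′

prime∣pCk : ∀ {p k} → Prime p → 0 < k → k < p → p ∣ p C k
prime∣pCk {p@(suc q)} {k} p-prime 0<k k<p
  with euclidsLemma (p C k) (k ! * (p ∸ k) !) p-prime p∣pCk*k!*[p∸k]!
  where
  instance _ = k !* (p ∸ k) !≢0
  p∣pCk*k!*[p∸k]! : p ∣ (p C k) * (k ! * (p ∸ k) !)
  p∣pCk*k!*[p∸k]! = subst (p ∣_) (sym (begin
      (p C k) * (k ! * (p ∸ k) !)         ≡⟨ cong (_* (k ! * (p ∸ k) !)) (nCk≡n!/k![n-k]! (<⇒≤ k<p)) ⟩
      p ! / (k ! * (p ∸ k) !) * (k ! * (p ∸ k) !) ≡⟨ m/n*n≡m (k![n∸k]!∣n! (<⇒≤ k<p)) ⟩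
      p !                               ∎))
    (m∣m*n (q !))
    where open ≡-Reasoning
... | inj₁ p∣pCk = p∣pCk
... | inj₂ p∣k!*[p∸k]! = ⊥-elim (
  [ prime∤n! p-prime k<p , prime∤n! p-prime (∸-monoʳ-< 0<k (<⇒≤ k<p)) ]′
    (euclidsLemma (k !) ((p ∸ k) !) p-prime p∣k!*[p∸k]!))

binomial-theorem : ∀ a n → (a + 1) ^ n ≡ Σ (λ (k : Fin (suc n)) → (n C Fin.toℕ k) * a ^ Fin.toℕ k)
binomial-theorem a n = begin
  (a + 1) ^ n                        ≡⟨ sym (^≡^ (a + 1) n) ⟩
  (a + 1) Exp.^ n                    ≡⟨ Binomial.theorem n a 1 ⟩
  Binomial.binomialExpansion a 1 n   ≡⟨ Sum.sum-cong-≗ {suc n} term≡ ⟩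
  Σ {suc n} (λ k → (n C Fin.toℕ k) * a ^ Fin.toℕ k) ∎
  where
  open ≡-Reasoning
  ^≡^ : ∀ x k → x Exp.^ k ≡ x ^ k
  ^≡^ x zero = refl
  ^≡^ x (suc k) = cong (x *_) (^≡^ x k)
  ×≡* : ∀ k x → k Mult.× x ≡ k * x
  ×≡* zero x = refl
  ×≡* (suc k) x = cong (x +_) (×≡* k x)
  1^≡1 : ∀ k → 1 Exp.^ k ≡ 1
  1^≡1 k = trans (^≡^ 1 k) (^-zeroˡ k)
  term≡ : ∀ k → Binomial.binomialTerm a 1 n k ≡ (n C Fin.toℕ k) * a ^ Fin.toℕ k
  term≡ k = trans (×≡* (n C Fin.toℕ k) _) (cong ((n C Fin.toℕ k) *_) (begin
    a Exp.^ Fin.toℕ k * 1 Exp.^ (n ∸ Fin.toℕ k)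
      ≡⟨ cong₂ _*_ (^≡^ a (Fin.toℕ k)) (1^≡1 (n ∸ Fin.toℕ k)) ⟩
    a ^ Fin.toℕ k * 1 ≡⟨ *-identityʳ _ ⟩
    a ^ Fin.toℕ k     ∎))

∣-Σ : ∀ {d m} (f : Fin m → ℕ) → (∀ i → d ∣ f i) → d ∣ Σ f
∣-Σ {d} {zero} f _ = d ∣0
∣-Σ {m = suc m} f d∣f = ∣m∣n⇒∣m+n (d∣f Fin.zero) (∣-Σ (f ∘ Fin.suc) (d∣f ∘ Fin.suc))

-- All binomial coefficients but the outer two are divisible by p.
freshmans-dream : ∀ {q} → Prime (suc q) → ∀ a → (a + 1) ^ suc q ≡ a ^ suc q + 1 mod suc q
freshmans-dream {q} p-prime a = middle , expansion , p∣middle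
  where
  p = suc q
  term : Fin (suc p) → ℕ
  term k = (p C Fin.toℕ k) * a ^ Fin.toℕ k
  inner = Vector.init (term ∘ Fin.suc)
  middle = Σ inner
  p∣middle : p ∣ middle
  p∣middle = ∣-Σ inner λ i → ∣m⇒∣m*n _ (prime∣pCk p-prime (s≤s z≤n)
    (s≤s (subst (_< q) (sym (Fin.toℕ-inject₁ i)) (Fin.toℕ<n i))))
  last≡a^p : Vector.last (term ∘ Fin.suc) ≡ a ^ p
  last≡a^p = begin
    term (Fin.suc (Fin.fromℕ q)) ≡⟨ cong (λ j → (p C suc j) * a ^ suc j) (Fin.toℕ-fromℕ q) ⟩
    (p C p) * a ^ p              ≡⟨ cong (_* a ^ p) (nCn≡1 p) ⟩
    1 * a ^ p                    ≡⟨ *-identityˡ _ ⟩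
    a ^ p                        ∎
    where open ≡-Reasoning
  expansion : (a + 1) ^ p ≡ a ^ p + 1 + middle
  expansion = begin
    (a + 1) ^ p                                      ≡⟨ binomial-theorem a p ⟩
    1 + Σ (term ∘ Fin.suc)                           ≡⟨ cong (1 +_) (Sum.sum-init-last (term ∘ Fin.suc)) ⟩
    1 + (middle + Vector.last (term ∘ Fin.suc))      ≡⟨ cong (λ z → 1 + (middle + z)) last≡a^p ⟩
    1 + (middle + a ^ p)                             ≡⟨ rearrange (a ^ p) middle ⟩
    a ^ p + 1 + middle                               ∎
    where
    open ≡-Reasoning
    rearrange : ∀ x y → 1 + (y + x) ≡ x + 1 + y
    rearrange = solve-∀

fermat : ∀ {q} → Prime (suc q) → ∀ a → a ^ suc q ≡ a mod suc q
fermat {q} p-prime zero = 0 , refl , suc q ∣0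
fermat {q} p-prime (suc a) =
  subst₂ (λ x y → x ≡ y mod suc q) (cong (_^ suc q) (+-comm a 1)) (+-comm a 1)
    (mod-trans (freshmans-dream p-prime a) (mod-+ (fermat p-prime a) mod-refl))

fermat-unit : ∀ {q} → Prime (suc q) → ∀ {a} → ¬ suc q ∣ a → a ^ q ≡ 1 mod suc q
fermat-unit {q} p-prime {zero} p∤0 = contradiction (suc q ∣0) p∤0
fermat-unit {q} p-prime {a@(suc _)} p∤a with fermat p-prime a
... | c , a^p≡a+c , p∣c = d , sym (m+[n∸m]≡n (m^n>0 a q)) , p∣d
  where
  d = a ^ q ∸ 1
  a*d≡c : a * d ≡ c
  a*d≡c = +-cancelˡ-≡ a _ _ (begin
    a + a * d     ≡⟨ sym (*-suc a d) ⟩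
    a * (1 + d)   ≡⟨ cong (a *_) (m+[n∸m]≡n (m^n>0 a q)) ⟩
    a ^ suc q     ≡⟨ a^p≡a+c ⟩
    a + c         ∎)
    where open ≡-Reasoning
  p∣d : suc q ∣ d
  p∣d with euclidsLemma a d p-prime (subst (suc q ∣_) (sym a*d≡c) p∣c)
  ... | inj₁ p∣a = contradiction p∣a p∤a
  ... | inj₂ p∣d′ = p∣d′

euler-prime-power : ∀ {q} → Prime (suc q) → ∀ {a} → ¬ suc q ∣ a → ∀ j →
                    a ^ (suc q ^ j * q) ≡ 1 mod suc q ^ suc j
euler-prime-power {q} p-prime {a} p∤a zero =
  subst (λ e → a ^ e ≡ 1 mod suc q * 1) (sym (*-identityˡ q))
    (mod-∣ (∣-reflexive (*-identityʳ (suc q))) (fermat-unit p-prime p∤a))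
euler-prime-power {q} p-prime {a} p∤a (suc j) =
  subst₂ (λ x n → x ≡ 1 mod n) exponent (*-comm (suc q ^ suc j) (suc q))
    (^-lift (m∣m*n (suc q ^ j)) (euler-prime-power p-prime p∤a j))
  where
  exponent : (a ^ (suc q ^ j * q)) ^ suc q ≡ a ^ (suc q ^ suc j * q)
  exponent = trans (^-*-assoc a (suc q ^ j * q) (suc q)) (cong (a ^_) (rearrange (suc q) (suc q ^ j) q))
    where
    rearrange : ∀ p x q → x * q * p ≡ p * x * q
    rearrange = solve-∀

module Totient {q} (k : ℕ) (p-prime : Prime (suc q)) where
  private
    p = suc q
    n = p ^ suc k

    coprime? : ∀ i → Dec (gcd i n ≡ 1)
    coprime? i = gcd i n ≟ 1

    coprimesUpTo : ℕ → ℕ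
    coprimesUpTo t = length (filter coprime? (map suc (upTo t)))

    coprimesUpTo-suc : ∀ t → coprimesUpTo (suc t) ≡ coprimesUpTo t + length (filter coprime? [ suc t ])
    coprimesUpTo-suc t = begin
      length (filter coprime? (map suc (upTo (suc t))))
        ≡⟨ cong (length ∘ filter coprime? ∘ map suc) (sym (List.upTo-∷ʳ t)) ⟩
      length (filter coprime? (map suc (upTo t ++ [ t ])))
        ≡⟨ cong (length ∘ filter coprime?) (List.map-++ suc (upTo t) [ t ]) ⟩
      length (filter coprime? (map suc (upTo t) ++ [ suc t ]))
        ≡⟨ cong length (List.filter-++ coprime? (map suc (upTo t)) [ suc t ]) ⟩
      length (filter coprime? (map suc (upTo t)) ++ filter coprime? [ suc t ])
        ≡⟨ List.length-++ (filter coprime? (map suc (upTo t))) ⟩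
      coprimesUpTo t + length (filter coprime? [ suc t ])
        ∎
      where open ≡-Reasoning

    coprimesUpTo-∤ : ∀ t → ¬ p ∣ suc t → coprimesUpTo (suc t) ≡ coprimesUpTo t + 1
    coprimesUpTo-∤ t p∤1+t = trans (coprimesUpTo-suc t)
      (cong (λ xs → coprimesUpTo t + length xs) (List.filter-accept coprime? {suc t} {[]} gcd≡1))
      where
      gcd≡1 : gcd (suc t) n ≡ 1
      gcd≡1 = coprime⇒gcd≡1 (Coprimality.sym (coprime-^ˡ (prime∤⇒coprime p-prime p∤1+t) (suc k)))

    coprimesUpTo-∣ : ∀ t → p ∣ suc t → coprimesUpTo (suc t) ≡ coprimesUpTo t + 0
    coprimesUpTo-∣ t p∣1+t = trans (coprimesUpTo-suc t)
      (cong (λ xs → coprimesUpTo t + length xs) (List.filter-reject coprime? {suc t} {[]} gcd≢1))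
      where
      gcd≢1 : ¬ gcd (suc t) n ≡ 1
      gcd≢1 gcd≡1 = nonTrivial⇒≢1 {{prime⇒nonTrivial p-prime}}
        (∣1⇒≡1 (subst (p ∣_) gcd≡1 (gcd-greatest p∣1+t (m∣m*n (p ^ k)))))

    coprimesUpTo-p*t : ∀ t → coprimesUpTo (p * t) ≡ t * q
    coprimesUpTo-p*t+j : ∀ t j → j ≤ q → coprimesUpTo (p * t + j) ≡ t * q + j

    coprimesUpTo-p*t zero = cong coprimesUpTo (*-zeroʳ p)
    coprimesUpTo-p*t (suc t) = begin
      coprimesUpTo (p * suc t)         ≡⟨ cong coprimesUpTo p*[1+t]≡1+[p*t+q] ⟩
      coprimesUpTo (suc (p * t + q))   ≡⟨ coprimesUpTo-∣ (p * t + q) p∣1+[p*t+q] ⟩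
      coprimesUpTo (p * t + q) + 0     ≡⟨ +-identityʳ _ ⟩
      coprimesUpTo (p * t + q)         ≡⟨ coprimesUpTo-p*t+j t q ≤-refl ⟩
      t * q + q                        ≡⟨ +-comm (t * q) q ⟩
      suc t * q                        ∎
      where
      open ≡-Reasoning
      p*[1+t]≡1+[p*t+q] : p * suc t ≡ suc (p * t + q)
      p*[1+t]≡1+[p*t+q] = trans (*-suc p t) (cong suc (+-comm q (p * t)))
      p∣1+[p*t+q] : p ∣ suc (p * t + q)
      p∣1+[p*t+q] = subst (p ∣_) p*[1+t]≡1+[p*t+q] (m∣m*n (suc t))
    coprimesUpTo-p*t+j t zero _ =
      trans (cong coprimesUpTo (+-identityʳ (p * t))) (trans (coprimesUpTo-p*t t) (sym (+-identityʳ _)))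
    coprimesUpTo-p*t+j t (suc j) 1+j≤q = begin
      coprimesUpTo (p * t + suc j)     ≡⟨ cong coprimesUpTo (+-suc (p * t) j) ⟩
      coprimesUpTo (suc (p * t + j))   ≡⟨ coprimesUpTo-∤ (p * t + j) p∤ ⟩
      coprimesUpTo (p * t + j) + 1     ≡⟨ cong (_+ 1) (coprimesUpTo-p*t+j t j (≤-trans (n≤1+n j) 1+j≤q)) ⟩
      t * q + j + 1                    ≡⟨ trans (+-assoc (t * q) j 1) (cong (t * q +_) (+-comm j 1)) ⟩
      t * q + suc j                    ∎
      where
      open ≡-Reasoning
      p∤ : ¬ p ∣ suc (p * t + j)
      p∤ p∣ = <⇒≱ (s≤s 1+j≤q) (∣⇒≤ (∣m+n∣m⇒∣n (subst (p ∣_) (sym (+-suc (p * t) j)) p∣) (m∣m*n t)))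

  φ[p^[1+k]] : φ (suc q ^ suc k) ≡ suc q ^ k * q
  φ[p^[1+k]] = coprimesUpTo-p*t (suc q ^ k)

open Totient using (φ[p^[1+k]])

infix 4 _≡±1mod_ _≡0,±1mod_
_≡±1mod_ : ℕ → ℕ → Set
t ≡±1mod n = t ≡ 1 mod n ⊎ 1 + t ≡ 0 mod n

_≡0,±1mod_ : ℕ → ℕ → Set
t ≡0,±1mod n = t ≡ 0 mod n ⊎ t ≡±1mod n

odd-prime-power∣m*[2+m] : ∀ {p} → Prime p → 3 ≤ p → ∀ K {m} → p ^ K ∣ m * (2 + m) →
                         p ^ K ∣ m ⊎ p ^ K ∣ 2 + m
odd-prime-power∣m*[2+m] {p} p-prime 3≤p K {m} ∣m*[2+m] with p ∣? m
... | yes p∣m = inj₁ (coprime-divisor (coprime-^ˡ (prime∤⇒coprime p-prime p∤2+m) K)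
                                      (subst (p ^ K ∣_) (*-comm m (2 + m)) ∣m*[2+m]))
  where
  p∤2+m : ¬ p ∣ 2 + m
  p∤2+m p∣2+m = <⇒≱ 3≤p (∣⇒≤ (∣m+n∣m⇒∣n (subst (p ∣_) (+-comm 2 m) p∣2+m) p∣m))
... | no p∤m = inj₂ (coprime-divisor (coprime-^ˡ (prime∤⇒coprime p-prime p∤m) K) ∣m*[2+m])

-- y = 1 + m with y² - 1 = m (2 + m), and an odd prime cannot divide both factors.
square≡1⇒≡±1 : ∀ {p} → Prime p → 3 ≤ p → ∀ K {y} → y * y ≡ 1 mod p ^ K → y ≡±1mod p ^ K
square≡1⇒≡±1 _ _ _ {zero} (_ , () , _)
square≡1⇒≡±1 p-prime 3≤p K {suc m} (c , y*y≡1+c , ∣c)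
  with odd-prime-power∣m*[2+m] p-prime 3≤p K (subst (_ ∣_) (sym m*[2+m]≡c) ∣c)
  where
  m*[2+m]≡c : m * (2 + m) ≡ c
  m*[2+m]≡c = trans (expand m) (suc-injective y*y≡1+c)
    where
    expand : ∀ m → m * (2 + m) ≡ m + m * suc m
    expand = solve-∀
... | inj₁ ∣m = inj₁ (m , refl , ∣m)
... | inj₂ ∣2+m = inj₂ (2 + m , refl , ∣2+m)

≡±1-respˡ : ∀ {n t y} → t ≡ y mod n → y ≡±1mod n → t ≡±1mod n
≡±1-respˡ t≡y (inj₁ y≡1) = inj₁ (mod-trans t≡y y≡1)
≡±1-respˡ t≡y (inj₂ 1+y≡0) = inj₂ (mod-trans (mod-+ {x = 1} mod-refl t≡y) 1+y≡0)

^-odd : ∀ {n y l} → y * y ≡ 1 mod n → Odd l → y ^ l ≡ y mod n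
^-odd {n} {y} y*y≡1 (j , refl) = subst₂ (λ x z → x ≡ z mod n) y*[y*y]^j≡y^l (*-identityʳ y)
  (mod-*ˡ y (mod-^ j y*y≡1))
  where
  y*[y*y]^j≡y^l : y * (y * y) ^ j ≡ y ^ suc (2 * j)
  y*[y*y]^j≡y^l = cong (y *_) (trans (cong (_^ j) (cong (y *_) (sym (*-identityʳ y)))) (^-*-assoc y 2 j))

odd-prime⇒even-pred : ∀ {q} → Prime (suc q) → 3 ≤ suc q → ∃ λ h → q ≡ h * 2
odd-prime⇒even-pred {q} p-prime 3≤p with q % 2 | m≡m%n+[m/n]*n q 2 | m%n<n q 2
... | 0 | q≡[q/2]*2 | _ = q / 2 , q≡[q/2]*2
... | 1 | q≡1+[q/2]*2 | _
  with prime⇒irreducible p-prime (divides (suc (q / 2)) (cong suc q≡1+[q/2]*2))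
...   | inj₁ ()
...   | inj₂ 2≡p = contradiction (≤-reflexive (sym 2≡p)) (<⇒≱ 3≤p)
odd-prime⇒even-pred p-prime 3≤p | suc (suc _) | _ | s≤s (s≤s ())

^-pres-∣ : ∀ {d x k e} → d ∣ x → k ≤ e → d ^ k ∣ x ^ e
^-pres-∣ _ z≤n = 1∣ _
^-pres-∣ d∣x (s≤s k≤e) = *-pres-∣ d∣x (^-pres-∣ d∣x k≤e)

n<m^n : ∀ {m} → 1 < m → ∀ n → n < m ^ n
n<m^n 1<m zero = s≤s z≤n
n<m^n {m@(suc _)} 1<m (suc n) =
  ≤-<-trans (n<m^n 1<m n) (subst (m ^ n <_) (*-comm (m ^ n) m) (m<m*n (m ^ n) m {{m^n≢0 m n}} 1<m))

φ[p^[1+k]]*l/2 : ∀ {q h} → Prime (suc q) → q ≡ h * 2 → ∀ k l →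
                 (φ (suc q ^ suc k) * l) / 2 ≡ suc q ^ k * h * l
φ[p^[1+k]]*l/2 {q} {h} p-prime q≡h*2 k l = begin
  (φ (suc q ^ suc k) * l) / 2   ≡⟨ cong (λ f → (f * l) / 2) φ[p^[1+k]]≡p^k*[h*2] ⟩
  (suc q ^ k * (h * 2) * l) / 2 ≡⟨ cong (_/ 2) (rearrange (suc q ^ k) h l) ⟩
  (suc q ^ k * h * l * 2) / 2   ≡⟨ m*n/n≡m (suc q ^ k * h * l) 2 ⟩
  suc q ^ k * h * l             ∎
  where
  open ≡-Reasoning
  φ[p^[1+k]]≡p^k*[h*2] : φ (suc q ^ suc k) ≡ suc q ^ k * (h * 2)
  φ[p^[1+k]]≡p^k*[h*2] = trans (φ[p^[1+k]] k p-prime) (cong (suc q ^ k *_) q≡h*2)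
  rearrange : ∀ x h l → x * (h * 2) * l ≡ x * h * l * 2
  rearrange = solve-∀

euler-half : ∀ {q h} → Prime (suc q) → q ≡ h * 2 → ∀ {x} → ¬ suc q ∣ x → ∀ k →
             x ^ (suc q ^ k * h) * x ^ (suc q ^ k * h) ≡ 1 mod suc q ^ suc k
euler-half {q} {h} p-prime q≡h*2 {x} p∤x k =
  subst (λ z → z ≡ 1 mod suc q ^ suc k) x^[p^k*q]≡x^E*x^E (euler-prime-power p-prime p∤x k)
  where
  E = suc q ^ k * h
  twice : ∀ x h → x * (h * 2) ≡ x * h + x * h
  twice = solve-∀
  x^[p^k*q]≡x^E*x^E : x ^ (suc q ^ k * q) ≡ x ^ E * x ^ E
  x^[p^k*q]≡x^E*x^E = trans (cong (x ^_) (trans (cong (suc q ^ k *_) q≡h*2) (twice (suc q ^ k) h)))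
                            (^-distribˡ-+-* x E E)

power-residue : ∀ {q} → Prime (suc q) → 3 ≤ suc q → ∀ k {l} → Odd l → ∀ x →
                x ^ ((φ (suc q ^ suc k) * l) / 2) ≡0,±1mod suc q ^ suc k
power-residue {q} p-prime 3≤p k {l} odd@(j , refl) x with odd-prime⇒even-pred p-prime 3≤p
... | h , q≡h*2 = subst (λ e → x ^ e ≡0,±1mod N) (sym (φ[p^[1+k]]*l/2 p-prime q≡h*2 k l)) residue
  where
  p = suc q
  N = p ^ suc k
  E = p ^ k * h
  instance
    h≢0 : NonZero h
    h≢0 = ≢-nonZero λ h≡0 → contradiction (subst (λ z → 3 ≤ suc z) (trans q≡h*2 (cong (_* 2) h≡0)) 3≤p)
                                          λ { (s≤s ()) }
  residue : x ^ (E * l) ≡0,±1mod N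
  residue with p ∣? x
  ... | yes p∣x = inj₁ (x ^ (E * l) , refl , ^-pres-∣ p∣x 1+k≤E*l)
    where
    1+k≤E*l : suc k ≤ E * l
    1+k≤E*l = ≤-trans (n<m^n (nonTrivial⇒n>1 p {{prime⇒nonTrivial p-prime}}) k)
                      (≤-trans (m≤m*n (p ^ k) h) (m≤m*n E l))
  ... | no p∤x = inj₂ (≡±1-respˡ (subst (λ z → z ≡ x ^ E mod N) (^-*-assoc x E l) (^-odd y*y≡1 odd))
                                 (square≡1⇒≡±1 p-prime 3≤p (suc k) y*y≡1))
    where
    y*y≡1 : x ^ E * x ^ E ≡ 1 mod N
    y*y≡1 = euler-half p-prime q≡h*2 p∤x k

-- c ≡ a − s (mod n): c is congruent to a sum of a terms 1 and s terms −1.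
SumOfSigns : ℕ → ℕ → ℕ → Set
SumOfSigns n m c = ∃ λ a → ∃ λ s → a + s ≤ m × c + s ≡ a mod n

Σ-sumOfSigns : ∀ {n m} (f : Fin m → ℕ) → (∀ i → f i ≡0,±1mod n) → SumOfSigns n m (Σ f)
Σ-sumOfSigns {m = zero} f _ = 0 , 0 , z≤n , mod-refl
Σ-sumOfSigns {n} {suc m} f residue with Σ-sumOfSigns (f ∘ Fin.suc) (residue ∘ Fin.suc) | residue Fin.zero
... | a , s , a+s≤m , r+s≡a | inj₁ t≡0 =
  a , s , m≤n⇒m≤1+n a+s≤m , subst (λ z → z ≡ a mod n) (sym (+-assoc (f Fin.zero) _ s)) (mod-+ t≡0 r+s≡a)
... | a , s , a+s≤m , r+s≡a | inj₂ (inj₁ t≡1) =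
  suc a , s , s≤s a+s≤m , subst (λ z → z ≡ suc a mod n) (sym (+-assoc (f Fin.zero) _ s)) (mod-+ t≡1 r+s≡a)
... | a , s , a+s≤m , r+s≡a | inj₂ (inj₂ 1+t≡0) =
  a , suc s , subst (_≤ suc m) (sym (+-suc a s)) (s≤s a+s≤m) ,
  subst (λ z → z ≡ a mod n) (rearrange (f Fin.zero) _ s) (mod-+ 1+t≡0 r+s≡a)
  where
  rearrange : ∀ t r s → 1 + t + (r + s) ≡ t + r + (1 + s)
  rearrange = solve-∀

sumOfSigns⇒%≤ : ∀ {n m b} .{{_ : NonZero n}} → SumOfSigns n m b → b % n + m < n → b % n ≤ m
sumOfSigns⇒%≤ {n} {m} {b} (a , s , a+s≤m , b+s≡a) r+m<n =
  ≤-trans (m≤m+n r s) (≤-trans (≤-reflexive r+s≡a) (m+n≤o⇒m≤o a a+s≤m))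
  where
  r = b % n
  m<n : m < n
  m<n = ≤-<-trans (m≤n+m m r) r+m<n
  r+s≡a : r + s ≡ a
  r+s≡a = begin
    r + s                   ≡⟨ sym (m<n⇒m%n≡m (≤-<-trans (+-monoʳ-≤ r (m+n≤o⇒n≤o a a+s≤m)) r+m<n)) ⟩
    (r + s) % n             ≡⟨ sym ([m+kn]%n≡m%n (r + s) (b / n) n) ⟩
    (r + s + b / n * n) % n ≡⟨ cong (_% n) (rearrange r s (b / n * n)) ⟩
    (r + b / n * n + s) % n ≡⟨ cong (λ z → (z + s) % n) (sym (m≡m%n+[m/n]*n b n)) ⟩
    (b + s) % n             ≡⟨ mod-% b+s≡a ⟩
    a % n                   ≡⟨ m<n⇒m%n≡m (≤-<-trans (m+n≤o⇒m≤o a a+s≤m) m<n) ⟩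
    a                       ∎
    where
    open ≡-Reasoning
    rearrange : ∀ r s w → r + s + w ≡ r + w + s
    rearrange = solve-∀

theorem7 : (p b k l m : ℕ) → Prime p → 3 ≤ p → Odd l →
           2 ≤ m → .{{_ : NonZero (p ^ k)}} → m < (p ^ k ∸ 1) / 2 →
           m + 1 ≤ b % (p ^ k) → b % (p ^ k) ≤ p ^ k ∸ m ∸ 1 →
           ¬ (∃ λ (x : Fin m → ℕ) → Σ (λ i → x i ^ ((φ (p ^ k) * l) / 2)) ≡ b)
theorem7 zero _ _ _ _ _ ()
theorem7 (suc q) b zero l m _ _ _ _ () _ _
theorem7 p@(suc q) b (suc k) l m p-prime 3≤p odd _ _ m+1≤r r≤N∸m∸1 (x , Σ≡b) =
  <⇒≱ (subst (_≤ r) (+-comm m 1) m+1≤r) (sumOfSigns⇒%≤ b-sumOfSigns r+m<N)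
  where
  N = p ^ suc k
  r = b % N
  b-sumOfSigns : SumOfSigns N m b
  b-sumOfSigns = subst (SumOfSigns N m) Σ≡b (Σ-sumOfSigns _ λ i → power-residue p-prime 3≤p k odd (x i))
  r+m<N : r + m < N
  r+m<N = subst (_≤ N) (trans (sym (+-assoc r m 1)) (+-comm (r + m) 1))
    (m≤o∸n⇒m+n≤o r (≤-trans m+1≤r (<⇒≤ (m%n<n b N))) (subst (r ≤_) (∸-+-assoc N m 1) r≤N∸m∸1))
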